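{- Let $k$ be an integer with $2\le k\le N-1$ such that $\phi^{k-1}-\phi^k>\phi^k-\phi^{k+1}$, and suppose there exists a labeled atom ${\tt Z}\in\aleph_k^\bullet$ such that ${\tt N}^{out}_{\tt Z}(F)=\emptyset$ for every $F\in\tilde{\cal F}^{k-1}$. Then $\tilde{\cal F}^{k-1}|_{\uparrow{\tt Z}}=\tilde{\cal F}^{k-1}|_{\tt Z}=\tilde{\cal T}^\bullet_{\tt Z}$; that is, for every $F\in\tilde{\cal F}^{k-1}$, $F|_{\uparrow{\tt Z}}=F|_{\tt Z}\in\tilde{\cal T}^\bullet_{\tt Z}$, and for every $T\in\tilde{\cal T}^\bullet_{\tt Z}$ there exists $Q\in\tilde{\cal F}^{k-1}$ with $Q|_{\uparrow{\tt Z}}=Q|_{\tt Z}=T$.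
   Context: $V$ is a directed graph without loops on a finite vertex set ${\tt N}$, $|{\tt N}|=N$; each arc $(i,j)$ has a real weight $v_{ij}$; $V$ is assumed to have at least one spanning tree. An (entering) forest is a directed graph in which at most one arc leaves each vertex and there are no directed cycles; its components are trees, the root of a tree being its unique vertex with no outgoing arc. All forests and trees are subgraphs of $V$. For a subgraph $G$ and ${\tt D}\subseteq{\tt N}$, $\Upsilon^G_{\tt D}=\sum_{i\in{\tt D},(i,j)\in G}v_{ij}$ (heads may lie outside ${\tt D}$), $\Upsilon^G=\Upsilon^G_{\tt N}$. ${\cal F}^j$: spanning forests of $V$ with exactly $j$ trees; $\phi^j=\min_{F\in{\cal F}^j}\Upsilon^F$ ($\phi^j=\infty$ if ${\cal F}^j=\emptyset$; $\phi^0=\infty$); $\tilde{\cal F}^j$: forests in ${\cal F}^j$ of weight $\phi^j$. $\mathfrak{A}_k$: algebra of subsets of ${\tt N}$ generated by the vertex sets of all trees of all forests in $\tilde{\cal F}^k$; $\aleph_k$: its atoms (nonempty elements ${\tt A}$ with ${\tt A}\cap{\tt B}\in\{\emptyset,{\tt A}\}$ for all ${\tt B}\in\mathfrak{A}_k$); $\aleph_k^\bullet$: labeled atoms (containing a root of some tree of some $F\in\tilde{\cal F}^k$). For ${\tt D}\subseteq{\tt N}$: ${\cal T}^\bullet_{\tt D}$ is the set of trees with vertex set ${\tt D}$, $\lambda^\bullet_{\tt D}=\min_{T\in{\cal T}^\bullet_{\tt D}}\Upsilon^T$, $\tilde{\cal T}^\bullet_{\tt D}=\{T\in{\cal T}^\bullet_{\tt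 D}:\Upsilon^T=\lambda^\bullet_{\tt D}\}$. $G|_{\tt D}$ is the induced subgraph on ${\tt D}$. ${\tt N}^{out}_{\tt D}(G)$ is the set of heads $j\notin{\tt D}$ of arcs $(i,j)\in G$ with $i\in{\tt D}$. The outgoing restriction $G|_{\uparrow{\tt D}}$ has as arcs exactly the arcs of $G$ with tail in ${\tt D}$ and vertex set ${\tt D}\cup{\tt N}^{out}_{\tt D}(G)$. -}

module Defs where

open import Level using (Level; _⊔_)
import Level
open import Data.Nat using (ℕ; zero; suc)
import Data.Nat as ℕ
open import Data.Fin using (Fin; zero; suc)
open import Data.Bool using (Bool; true; false; _∧_; _∨_; not; if_then_else_)
open import Data.Product using (Σ; ∃; ∃-syntax; _×_; _,_)
open import Data.Sum using (_⊎_)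
open import Relation.Nullary using (¬_)
open import Relation.Binary.PropositionalEquality using (_≡_; _≢_)
open import Algebra.Structures using (IsAbelianGroup)
open import Relation.Binary.Structures using (IsTotalOrder)

-- Weights: a totally ordered abelian group (the paper uses ℝ, which is one).

record OrderedAbelianGroup (c ℓ : Level) : Set (Level.suc (c ⊔ ℓ)) where
  infixl 6 _+_ _-_
  infix 4 _≤_ _<_
  field
    Carrier       : Set c
    _+_           : Carrier → Carrier → Carrier
    0#            : Carrier
    -_            : Carrier → Carrier
    _≤_           : Carrier → Carrier → Set ℓ
    isAbelianGroup : IsAbelianGroup _≡_ _+_ 0# -_
    isTotalOrder   : IsTotalOrder _≡_ _≤_
    +-monoˡ-≤      : ∀ {x y} z → x ≤ y → x + z ≤ y + z

  _-_ : Carrier → Carrier → Carrier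
  x - y = x + (- y)

  _<_ : Carrier → Carrier → Set (c ⊔ ℓ)
  x < y = x ≤ y × x ≢ y

anyF : ∀ {n} → (Fin n → Bool) → Bool
anyF {zero}  f = false
anyF {suc n} f = f zero ∨ anyF (λ i → f (suc i))

countF : ∀ {n} → (Fin n → Bool) → ℕ
countF {zero}  f = zero
countF {suc n} f = (if f zero then ℕ.suc else (λ m → m)) (countF (λ i → f (suc i)))

record Graph (N : ℕ) : Set where
  field
    vs : Fin N → Bool
    as : Fin N → Fin N → Bool
open Graph public

_≐_ : ∀ {N} → Graph N → Graph N → Set
G ≐ H = (∀ i → vs G i ≡ vs H i) × (∀ i j → as G i j ≡ as H i j)

data Path⁺ {N} (G : Graph N) : Fin N → Fin N → Set where
  [_] : ∀ {i j} → as G i j ≡ true → Path⁺ G i j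
  _∷_ : ∀ {i j k} → as G i j ≡ true → Path⁺ G j k → Path⁺ G i k

Reach* : ∀ {N} → Graph N → Fin N → Fin N → Set
Reach* G x y = x ≡ y ⊎ Path⁺ G x y

_∣_ : ∀ {N} → Graph N → (Fin N → Bool) → Graph N
G ∣ D = record { vs = D ; as = λ i j → D i ∧ D j ∧ as G i j }

-- outgoing restriction G|_{↑D}: arcs of G with tail in D, vertex set D ∪ N^out_D(G)
_∣↑_ : ∀ {N} → Graph N → (Fin N → Bool) → Graph N
G ∣↑ D = record { vs = λ j → D j ∨ anyF (λ i → D i ∧ as G i j)
                ; as = λ i j → D i ∧ as G i j }

NoOut : ∀ {N} → (Fin N → Bool) → Graph N → Set
NoOut D G = ∀ i j → D i ≡ true → as G i j ≡ true → D j ≡ true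

Root : ∀ {N} → Graph N → Fin N → Set
Root G r = vs G r ≡ true × (∀ j → as G r j ≡ false)

-- number of roots (= number of trees of a forest)
numRoots : ∀ {N} → Graph N → ℕ
numRoots G = countF (λ i → vs G i ∧ not (anyF (as G i)))

module Weighted {c ℓ} (W : OrderedAbelianGroup c ℓ) {N : ℕ}
                (V : Fin N → Fin N → Bool) (v : Fin N → Fin N → OrderedAbelianGroup.Carrier W) where
  open OrderedAbelianGroup W
  open OrderedAbelianGroup W public using (_-_; _<_)

  sumF : ∀ {n} → (Fin n → Carrier) → Carrier
  sumF {zero}  f = 0#
  sumF {suc n} f = f zero + sumF (λ i → f (suc i))

  Υ : Graph N → Carrier
  Υ G = sumF (λ i → sumF (λ j → if as G i j then v i j else 0#))

  IsSubgraph : Graph N → Set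
  IsSubgraph G = ∀ i j → as G i j ≡ true →
                   vs G i ≡ true × vs G j ≡ true × V i j ≡ true

  Forest : Graph N → Set
  Forest G = IsSubgraph G
           × (∀ i j j′ → as G i j ≡ true → as G i j′ ≡ true → j ≡ j′)
           × (∀ i → ¬ Path⁺ G i i)

  SF : ℕ → Graph N → Set
  SF j F = Forest F × (∀ i → vs F i ≡ true) × numRoots F ≡ j

  MinSF : ℕ → Graph N → Set ℓ
  MinSF j F = SF j F × (∀ G → SF j G → Υ F ≤ Υ G)

  IsPhi : ℕ → Carrier → Set (c ⊔ ℓ)
  IsPhi j a = ∃[ F ] (MinSF j F × Υ F ≡ a)

  Tree : (Fin N → Bool) → Graph N → Set
  Tree D T = Forest T × (∀ i → vs T i ≡ D i)
           × ∃[ r ] (Root T r × (∀ x → vs T x ≡ true → Reach* T x r))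

  MinTree : (Fin N → Bool) → Graph N → Set ℓ
  MinTree D T = Tree D T × (∀ T′ → Tree D T′ → Υ T ≤ Υ T′)

  TreeSetOf : Graph N → Fin N → (Fin N → Bool) → Set
  TreeSetOf F r A = ∀ x → (A x ≡ true → vs F x ≡ true × Reach* F x r)
                        × (vs F x ≡ true × Reach* F x r → A x ≡ true)

  data InAlg (k : ℕ) : (Fin N → Bool) → Set ℓ where
    gen   : ∀ {A} F r → MinSF k F → Root F r → TreeSetOf F r A → InAlg k A
    full  : InAlg k (λ _ → true)
    compl : ∀ {A} → InAlg k A → InAlg k (λ x → not (A x))
    union : ∀ {A B} → InAlg k A → InAlg k B → InAlg k (λ x → A x ∨ B x)
    ext   : ∀ {A B} → (∀ x → A x ≡ B x) → InAlg k A → InAlg k B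

  Atom : ℕ → (Fin N → Bool) → Set ℓ
  Atom k A = InAlg k A × (∃[ x ] A x ≡ true)
           × (∀ B → InAlg k B →
                (∀ x → A x ≡ true → B x ≡ true)
              ⊎ (∀ x → A x ≡ true → B x ≡ false))

  LabeledAtom : ℕ → (Fin N → Bool) → Set ℓ
  LabeledAtom k A = Atom k A × ∃[ F ] ∃[ r ] (MinSF k F × Root F r × A r ≡ true)

{-# OPTIONS --safe #-}
module Submission where

-- Let G ∈ 𝓕̃^k and F ∈ 𝓕̃^{k-1}.  G has one tree more than F, so some tree of G contains no root
-- of F.  Exchanging the arcs with tail in that tree between G and F gives forests Y and X
-- with k and k - 1 trees and Υ X + Υ Y = Υ F + Υ G; as Υ F ≤ Υ X, Y ∈ 𝓕̃^k, and every root of F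
-- is still a root of Y.  For a root x of F in Z, the vertex set of the tree of Y rooted at x lies
-- in 𝔄_k and meets the atom Z, so it contains Z, and x is the only root of F in Z.  As no arc of F
-- leaves Z, F|_Z is then a tree on Z.  Replacing it by any tree T on Z gives a spanning forest Q
-- with k - 1 trees and Υ Q + Υ(F|_Z) = Υ T + Υ F: minimality of F makes F|_Z a minimum tree on Z,
-- and minimality of T makes Q a minimum forest.

open import Algebra.Bundles using (CommutativeSemigroup)
open import Algebra.Structures using (IsAbelianGroup)
open import Data.Bool using (Bool; true; false; _∧_; _∨_; not; if_then_else_)
open import Data.Bool.Properties
  using ( ∧-conicalˡ; ∧-conicalʳ; ∧-zeroʳ; ∧-identityʳ; ∨-conicalˡ; ∨-conicalʳ
        ; not-injective; if-eta; if-not)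
open import Data.Empty using (⊥-elim)
open import Data.Fin using (Fin; zero; suc)
open import Data.Fin.Properties using (_≟_)
open import Data.Nat using (ℕ; zero; suc; _+_; _≤_; _∸_; s≤s)
import Data.Nat as ℕ
open import Data.Nat.Properties using (≤-reflexive; ≤-trans; n≤1+n; n<1+n; <⇒≱; suc-injective; +-suc)
open import Data.Product using (∃-syntax; _×_; _,_; proj₁; proj₂)
open import Data.Sum using (_⊎_; inj₁; inj₂; [_,_]′)
open import Function using (_∘_)
open import Relation.Binary.PropositionalEquality
  using (_≡_; _≢_; refl; sym; trans; cong; cong₂; subst; subst₂; module ≡-Reasoning)
open import Relation.Binary.Structures using (IsTotalOrder)
open import Relation.Nullary using (¬_; does; yes; no)
open import Relation.Nullary.Decidable using (dec-true; dec-false)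

open import Defs

true≢false : true ≢ false
true≢false ()

anyF≡true⇒∃ : ∀ {n} (f : Fin n → Bool) → anyF f ≡ true → ∃[ i ] f i ≡ true
anyF≡true⇒∃ {suc n} f any with f zero in f₀
... | true  = zero , f₀
... | false = let i , fi = anyF≡true⇒∃ (f ∘ suc) any in suc i , fi

anyF≡false⇒∀ : ∀ {n} (f : Fin n → Bool) → anyF f ≡ false → ∀ i → f i ≡ false
anyF≡false⇒∀ f none zero    = ∨-conicalˡ _ _ none
anyF≡false⇒∀ f none (suc i) = anyF≡false⇒∀ (f ∘ suc) (∨-conicalʳ _ _ none) i

∀⇒anyF≡false : ∀ {n} (f : Fin n → Bool) → (∀ i → f i ≡ false) → anyF f ≡ false
∀⇒anyF≡false {zero}  f none = refl
∀⇒anyF≡false {suc n} f none rewrite none zero = ∀⇒anyF≡false (f ∘ suc) (none ∘ suc)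

countF-cong : ∀ {n} {f g : Fin n → Bool} → (∀ i → f i ≡ g i) → countF f ≡ countF g
countF-cong {zero}  f≗g = refl
countF-cong {suc n} f≗g =
  cong₂ (λ b m → (if b then suc else λ m → m) m) (f≗g zero) (countF-cong (f≗g ∘ suc))

countF-none : ∀ {n} (f : Fin n → Bool) → (∀ i → f i ≡ false) → countF f ≡ 0
countF-none {zero}  f none = refl
countF-none {suc n} f none rewrite none zero = countF-none (f ∘ suc) (none ∘ suc)

countF≡0⇒none : ∀ {n} (f : Fin n → Bool) → countF f ≡ 0 → ∀ i → f i ≡ false
countF≡0⇒none {suc n} f count i with f zero in f₀
countF≡0⇒none {suc n} f ()    i       | true
countF≡0⇒none {suc n} f count zero    | false = f₀
countF≡0⇒none {suc n} f count (suc i) | false = countF≡0⇒none (f ∘ suc) count i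

countF≡suc⇒∃ : ∀ {n} (f : Fin n → Bool) {m} → countF f ≡ suc m → ∃[ i ] f i ≡ true
countF≡suc⇒∃ {suc n} f count with f zero in f₀
... | true  = zero , f₀
... | false = let i , fi = countF≡suc⇒∃ (f ∘ suc) count in suc i , fi

countF-if : ∀ {n} (S f g : Fin n → Bool) →
            countF (λ i → if S i then f i else g i)
              ≡ countF (λ i → S i ∧ f i) + countF (λ i → not (S i) ∧ g i)
countF-if {zero}  S f g = refl
countF-if {suc n} S f g with S zero | f zero | g zero
... | true  | true  | _     = cong suc (countF-if (S ∘ suc) (f ∘ suc) (g ∘ suc))
... | true  | false | _     = countF-if (S ∘ suc) (f ∘ suc) (g ∘ suc)
... | false | _     | true  = trans (cong suc (countF-if (S ∘ suc) (f ∘ suc) (g ∘ suc))) (sym (+-suc _ _))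
... | false | _     | false = countF-if (S ∘ suc) (f ∘ suc) (g ∘ suc)

countF-split : ∀ {n} (S f : Fin n → Bool) →
               countF f ≡ countF (λ i → S i ∧ f i) + countF (λ i → not (S i) ∧ f i)
countF-split S f = trans (countF-cong (λ i → sym (if-eta (S i)))) (countF-if S f f)

countF-∧≡0 : ∀ {n} (S f : Fin n → Bool) → (∀ i → f i ≡ true → S i ≡ false) →
             countF (λ i → S i ∧ f i) ≡ 0
countF-∧≡0 S f disjoint = countF-none _ pointwise
  where
  pointwise : ∀ i → S i ∧ f i ≡ false
  pointwise i with f i in fi
  ... | false = ∧-zeroʳ (S i)
  ... | true  = trans (∧-identityʳ (S i)) (disjoint i fi)

countF-not-∧≡countF : ∀ {n} (S f : Fin n → Bool) → (∀ i → f i ≡ true → S i ≡ false) →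
                   countF (λ i → not (S i) ∧ f i) ≡ countF f
countF-not-∧≡countF S f disjoint =
  sym (trans (countF-split S f) (cong (_+ countF (λ i → not (S i) ∧ f i)) (countF-∧≡0 S f disjoint)))

does-≟⇒≡ : ∀ {n} {x y : Fin n} → does (x ≟ y) ≡ true → x ≡ y
does-≟⇒≡ {x = x} {y} e with x ≟ y
... | yes x≡y = x≡y
... | no _    = ⊥-elim (true≢false (sym e))

infixl 6 _∖_

_∖_ : ∀ {n} → (Fin n → Bool) → Fin n → Fin n → Bool
(f ∖ x) i = f i ∧ not (does (i ≟ x))

∖-sound : ∀ {n} (f : Fin n → Bool) {x i} → (f ∖ x) i ≡ true → f i ≡ true × i ≢ x
∖-sound f {x} {i} e with i ≟ x
... | yes _   = ⊥-elim (true≢false (trans (sym e) (∧-zeroʳ (f i))))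
... | no i≢x = trans (sym (∧-identityʳ (f i))) e , i≢x

∖-complete : ∀ {n} (f : Fin n → Bool) {x i} → f i ≡ true → i ≢ x → (f ∖ x) i ≡ true
∖-complete f {x} {i} fi i≢x = cong₂ (λ a b → a ∧ not b) fi (dec-false (i ≟ x) i≢x)

∖-false : ∀ {n} (f : Fin n → Bool) {x i} → (f ∖ x) i ≡ false → f i ≡ false ⊎ i ≡ x
∖-false f {x} {i} e with i ≟ x | f i
... | yes i≡x | _     = inj₂ i≡x
... | no _    | false = inj₁ refl
... | no _    | true  = ⊥-elim (true≢false e)

countF-∖ : ∀ {n} (f : Fin n → Bool) {x} → f x ≡ true → countF f ≡ suc (countF (f ∖ x))
countF-∖ {suc n} f {zero} fx rewrite fx = cong suc (countF-cong (λ i → sym (∧-identityʳ (f (suc i)))))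
countF-∖ {suc n} f {suc x} fx with f zero
... | true  = cong suc (countF-∖ (f ∘ suc) fx)
... | false = countF-∖ (f ∘ suc) fx

countF≤suc-∖ : ∀ {n} (f : Fin n → Bool) x → countF f ≤ suc (countF (f ∖ x))
countF≤suc-∖ f x with f x in fx
... | true  = ≤-reflexive (countF-∖ f fx)
... | false = ≤-trans (≤-reflexive (countF-cong unchanged)) (n≤1+n _)
  where
  unchanged : ∀ i → f i ≡ (f ∖ x) i
  unchanged i with i ≟ x
  ... | yes refl = trans fx (sym (∧-zeroʳ (f x)))
  ... | no _     = sym (∧-identityʳ (f i))

countF-unique : ∀ {n} (f : Fin n → Bool) {x} → f x ≡ true → (∀ y → f y ≡ true → y ≡ x) →
                countF f ≡ 1
countF-unique f {x} fx unique = trans (countF-∖ f fx) (cong suc (countF-none (f ∖ x) onlyX))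
  where
  onlyX : ∀ i → (f ∖ x) i ≡ false
  onlyX i with (f ∖ x) i in e
  ... | false = refl
  ... | true  = let fi , i≢x = ∖-sound f e in ⊥-elim (i≢x (unique i fi))

countF-≤-cover : ∀ {n} (P Q : Fin n → Bool) (g : Fin n → Fin n) →
                 (∀ y → P y ≡ true → ∃[ x ] (Q x ≡ true × g x ≡ y)) → countF P ≤ countF Q
countF-≤-cover P Q g cover = go (countF Q) P Q refl cover
  where
  go : ∀ m P Q → countF Q ≡ m → (∀ y → P y ≡ true → ∃[ x ] (Q x ≡ true × g x ≡ y)) →
       countF P ≤ m
  go zero P Q countQ cover = ≤-reflexive (countF-none P noP)
    where
    noP : ∀ y → P y ≡ false
    noP y with P y in py
    ... | false = refl
    ... | true  = let x , qx , _ = cover y py in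
                  ⊥-elim (true≢false (trans (sym qx) (countF≡0⇒none Q countQ x)))
  go (suc m) P Q countQ cover with countF≡suc⇒∃ Q countQ
  ... | x₀ , qx₀ = ≤-trans (countF≤suc-∖ P (g x₀)) (s≤s (go m (P ∖ g x₀) (Q ∖ x₀) countQ′ cover′))
    where
    countQ′ : countF (Q ∖ x₀) ≡ m
    countQ′ = suc-injective (trans (sym (countF-∖ Q qx₀)) countQ)

    cover′ : ∀ y → (P ∖ g x₀) y ≡ true → ∃[ x ] ((Q ∖ x₀) x ≡ true × g x ≡ y)
    cover′ y e = let py , y≢gx₀ = ∖-sound P e
                     x , qx , gx≡y = cover y py
                 in x , ∖-complete Q qx (λ x≡x₀ → y≢gx₀ (trans (sym gx≡y) (cong g x≡x₀))) , gx≡y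

-- The point is found by a decidable search; if there were none, every point of P would be g of a
-- point of Q.
countF-<⇒uncovered : ∀ {n} (P Q : Fin n → Bool) (g : Fin n → Fin n) → countF Q ℕ.< countF P →
                     ∃[ y ] (P y ≡ true × ∀ x → Q x ≡ true → g x ≢ y)
countF-<⇒uncovered P Q g Q<P = decide (anyF uncovered) refl
  where
  hit : Fin _ → Bool
  hit y = anyF (λ x → Q x ∧ does (g x ≟ y))

  uncovered : Fin _ → Bool
  uncovered y = P y ∧ not (hit y)

  decide : ∀ b → anyF uncovered ≡ b → ∃[ y ] (P y ≡ true × ∀ x → Q x ≡ true → g x ≢ y)
  decide true e =
    let y , uy = anyF≡true⇒∃ uncovered e
        missed = anyF≡false⇒∀ _ (not-injective (∧-conicalʳ _ _ uy))
    in y , ∧-conicalˡ _ _ uy ,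
       λ x qx gx≡y → true≢false (trans (sym (cong₂ _∧_ qx (dec-true (g x ≟ y) gx≡y))) (missed x))
  decide false e = ⊥-elim (<⇒≱ Q<P (countF-≤-cover P Q g cover))
    where
    cover : ∀ y → P y ≡ true → ∃[ x ] (Q x ≡ true × g x ≡ y)
    cover y py =
      let hity = not-injective (trans (cong (_∧ not (hit y)) (sym py)) (anyF≡false⇒∀ _ e y))
          x , hx = anyF≡true⇒∃ _ hity
      in x , ∧-conicalˡ _ _ hx , does-≟⇒≡ (∧-conicalʳ _ _ hx)

module _ {N : ℕ} where

  OutDegree≤1 : Graph N → Set
  OutDegree≤1 G = ∀ i j j′ → as G i j ≡ true → as G i j′ ≡ true → j ≡ j′

  Acyclic : Graph N → Set
  Acyclic G = ∀ i → ¬ Path⁺ G i i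

  Sink : Graph N → Fin N → Set
  Sink G x = ∀ j → as G x j ≡ false

  isSink : Graph N → Fin N → Bool
  isSink G x = not (anyF (as G x))

  isSink⇒Sink : ∀ {G x} → isSink G x ≡ true → Sink G x
  isSink⇒Sink e = anyF≡false⇒∀ _ (not-injective e)

  Sink⇒isSink : ∀ {G x} → Sink G x → isSink G x ≡ true
  Sink⇒isSink s = cong not (∀⇒anyF≡false _ s)

  numRoots-spanning : ∀ {G} → (∀ i → vs G i ≡ true) → numRoots G ≡ countF (isSink G)
  numRoots-spanning {G} spanning = countF-cong (λ i → cong (_∧ isSink G i) (spanning i))

  Path⁺-map : ∀ {G H : Graph N} → (∀ {i j} → as G i j ≡ true → as H i j ≡ true) →
              ∀ {x y} → Path⁺ G x y → Path⁺ H x y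
  Path⁺-map G⊆H [ e ]   = [ G⊆H e ]
  Path⁺-map G⊆H (e ∷ p) = G⊆H e ∷ Path⁺-map G⊆H p

  infixr 5 _∷*_
  infixl 5 _∷ʳ_ _*∷ʳ_

  _∷*_ : ∀ {G : Graph N} {x y z} → as G x y ≡ true → Reach* G y z → Path⁺ G x z
  e ∷* inj₁ refl = [ e ]
  e ∷* inj₂ p    = e ∷ p

  _∷ʳ_ : ∀ {G : Graph N} {x y z} → Path⁺ G x y → as G y z ≡ true → Path⁺ G x z
  [ e ]   ∷ʳ e′ = e ∷ [ e′ ]
  (e ∷ p) ∷ʳ e′ = e ∷ (p ∷ʳ e′)

  _*∷ʳ_ : ∀ {G : Graph N} {x y z} → Reach* G x y → as G y z ≡ true → Path⁺ G x z
  inj₁ refl *∷ʳ e = [ e ]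
  inj₂ p    *∷ʳ e = p ∷ʳ e

  Sink⇒¬Path⁺ : ∀ {G x y} → Sink G x → ¬ Path⁺ G x y
  Sink⇒¬Path⁺ sink ([_] {j = j} e) = true≢false (trans (sym e) (sink j))
  Sink⇒¬Path⁺ sink (_∷_ {j = j} e _) = true≢false (trans (sym e) (sink j))

  Sink-Reach*⇒≡ : ∀ {G x y} → Sink G x → Reach* G x y → x ≡ y
  Sink-Reach*⇒≡ sink (inj₁ x≡y) = x≡y
  Sink-Reach*⇒≡ sink (inj₂ p)   = ⊥-elim (Sink⇒¬Path⁺ sink p)

  Path⁺-step : ∀ {G x j y} → OutDegree≤1 G → as G x j ≡ true → Path⁺ G x y → Reach* G j y
  Path⁺-step outDeg e [ e′ ]   = inj₁ (outDeg _ _ _ e e′)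
  Path⁺-step outDeg e (e′ ∷ p) with outDeg _ _ _ e e′
  ... | refl = inj₂ p

  Reach*-Sink-unique : ∀ {G x r r′} → OutDegree≤1 G → Sink G r → Sink G r′ →
                       Reach* G x r → Reach* G x r′ → r ≡ r′
  Reach*-Sink-unique outDeg sink sink′ (inj₁ refl) q = Sink-Reach*⇒≡ sink q
  Reach*-Sink-unique outDeg sink sink′ (inj₂ p) (inj₁ refl) = sym (Sink-Reach*⇒≡ sink′ (inj₂ p))
  Reach*-Sink-unique outDeg sink sink′ (inj₂ [ e ]) (inj₂ q) = Sink-Reach*⇒≡ sink (Path⁺-step outDeg e q)
  Reach*-Sink-unique outDeg sink sink′ (inj₂ (e ∷ p)) (inj₂ q) =
    Reach*-Sink-unique outDeg sink sink′ (inj₂ p) (Path⁺-step outDeg e q)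

  AtMostOneSinkIn : (Fin N → Bool) → Graph N → Set
  AtMostOneSinkIn D F = ∀ {x y} → D x ≡ true → D y ≡ true → Sink F x → Sink F y → x ≡ y

  -- Follow arcs, keeping the set R of unvisited vertices: every visited vertex reaches the current
  -- one, so an arc back into a visited vertex would close a cycle, and each step shrinks R.
  reachesSink : ∀ {G} → Acyclic G → ∀ x → ∃[ r ] (Sink G r × Reach* G x r)
  reachesSink {G} acyclic x = walk _ (λ _ → true) x refl (λ _ ())
    where
    walk : ∀ m R x → countF R ≡ m → (∀ u → R u ≡ false → Reach* G u x) →
           ∃[ r ] (Sink G r × Reach* G x r)
    walk m R x countR visited with anyF (as G x) in out
    ... | false = x , anyF≡false⇒∀ _ out , inj₁ refl
    ... | true with anyF≡true⇒∃ _ out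
    ... | j , x→j with R j in rj
    ... | false = ⊥-elim (acyclic j (visited j rj *∷ʳ x→j))
    walk zero R x countR visited | true | j , x→j | true =
      ⊥-elim (true≢false (trans (sym rj) (countF≡0⇒none R countR j)))
    walk (suc m) R x countR visited | true | j , x→j | true =
      let r , sink , j↝r = walk m (R ∖ j) j (suc-injective (trans (sym (countF-∖ R rj)) countR)) visited′
      in r , sink , inj₂ (x→j ∷* j↝r)
      where
      visited′ : ∀ u → (R ∖ j) u ≡ false → Reach* G u j
      visited′ u e with ∖-false R e
      ... | inj₁ ru   = inj₂ (visited u ru *∷ʳ x→j)
      ... | inj₂ refl = inj₁ refl

  module Roots {G : Graph N} (outDeg : OutDegree≤1 G) (acyclic : Acyclic G) where

    rootOf : Fin N → Fin N
    rootOf x = proj₁ (reachesSink acyclic x)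

    rootOf-sink : ∀ x → Sink G (rootOf x)
    rootOf-sink x = proj₁ (proj₂ (reachesSink acyclic x))

    rootOf-reach : ∀ x → Reach* G x (rootOf x)
    rootOf-reach x = proj₂ (proj₂ (reachesSink acyclic x))

    rootOf-unique : ∀ {x r} → Sink G r → Reach* G x r → rootOf x ≡ r
    rootOf-unique sink x↝r = Reach*-Sink-unique outDeg (rootOf-sink _) sink (rootOf-reach _) x↝r

    rootOf-arc : ∀ {x j} → as G x j ≡ true → rootOf x ≡ rootOf j
    rootOf-arc x→j = rootOf-unique (rootOf-sink _) (inj₂ (x→j ∷* rootOf-reach _))

    treeOf : Fin N → Fin N → Bool
    treeOf r i = does (rootOf i ≟ r)

    treeOf-sound : ∀ {r i} → treeOf r i ≡ true → Reach* G i r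
    treeOf-sound {r} {i} t = subst (Reach* G i) (does-≟⇒≡ t) (rootOf-reach i)

    treeOf-complete : ∀ {r i} → Sink G r → Reach* G i r → treeOf r i ≡ true
    treeOf-complete {r} {i} sink i↝r = dec-true (rootOf i ≟ r) (rootOf-unique sink i↝r)

    treeOf-arc : ∀ {r i j} → as G i j ≡ true → treeOf r i ≡ treeOf r j
    treeOf-arc {r} e = cong (λ x → does (x ≟ r)) (rootOf-arc e)

    treeOf-closed : ∀ {r} → NoOut (treeOf r) G
    treeOf-closed i j t e = trans (sym (treeOf-arc e)) t

    treeOf-closedᶜ : ∀ {r} → NoOut (not ∘ treeOf r) G
    treeOf-closedᶜ i j t e = trans (cong not (sym (treeOf-arc e))) t

    countF-treeOf-sinks : ∀ {r} → Sink G r → countF (λ i → treeOf r i ∧ isSink G i) ≡ 1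
    countF-treeOf-sinks sink =
      countF-unique _ (cong₂ _∧_ (treeOf-complete sink (inj₁ refl)) (Sink⇒isSink {G} sink))
        (λ x h → Sink-Reach*⇒≡ (isSink⇒Sink {G} (∧-conicalʳ _ _ h)) (treeOf-sound (∧-conicalˡ _ _ h)))

    countF-sinks-outside-treeOf : ∀ {r} → Sink G r →
                                  suc (countF (λ i → not (treeOf r i) ∧ isSink G i)) ≡ countF (isSink G)
    countF-sinks-outside-treeOf {r} sink =
      trans (cong (_+ countF (λ i → not (treeOf r i) ∧ isSink G i)) (sym (countF-treeOf-sinks sink)))
            (sym (countF-split (treeOf r) (isSink G)))

  splice : (Fin N → Bool) → Graph N → Graph N → Graph N
  splice S A B = record { vs = λ _ → true ; as = λ i j → if S i then as A i j else as B i j }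

  module _ {S : Fin N → Bool} {A B : Graph N} where

    splice-inside : ∀ {i j} → S i ≡ true → as (splice S A B) i j ≡ as A i j
    splice-inside s = cong (λ b → if b then _ else _) s

    splice-outside : ∀ {i j} → S i ≡ false → as (splice S A B) i j ≡ as B i j
    splice-outside s = cong (λ b → if b then _ else _) s

    splice-outDegree≤1 : OutDegree≤1 A → OutDegree≤1 B → OutDegree≤1 (splice S A B)
    splice-outDegree≤1 outA outB i with S i
    ... | true  = outA i
    ... | false = outB i

    module _ (closed : NoOut S A) where

      splice-stays : ∀ {i j} → S i ≡ true → Path⁺ (splice S A B) i j → Path⁺ A i j × S j ≡ true
      splice-stays s [ e ] = let a = trans (sym (splice-inside s)) e in [ a ] , closed _ _ s a
      splice-stays s (e ∷ p) =
        let a = trans (sym (splice-inside s)) e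
            q , sj = splice-stays (closed _ _ s a) p
        in a ∷ q , sj

      splice-enters : ∀ {i j} → S i ≡ false → Path⁺ (splice S A B) i j → Path⁺ B i j ⊎ S j ≡ true
      splice-enters s [ e ] = inj₁ [ trans (sym (splice-outside s)) e ]
      splice-enters s (_∷_ {j = m} e p) with S m in sm
      ... | true  = inj₂ (proj₂ (splice-stays sm p))
      ... | false with splice-enters sm p
      ...   | inj₁ q  = inj₁ (trans (sym (splice-outside s)) e ∷ q)
      ...   | inj₂ sj = inj₂ sj

      splice-acyclic : Acyclic A → Acyclic B → Acyclic (splice S A B)
      splice-acyclic acycA acycB i p with S i in s
      ... | true = acycA i (proj₁ (splice-stays s p))
      ... | false with splice-enters s p
      ...   | inj₁ q  = acycB i q
      ...   | inj₂ si = true≢false (trans (sym si) s)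

  splice-acyclicᶜ : ∀ {S A B} → NoOut (not ∘ S) B → Acyclic A → Acyclic B → Acyclic (splice S A B)
  splice-acyclicᶜ {S} {A} {B} closed acycA acycB i p =
    splice-acyclic {not ∘ S} {B} {A} closed acycB acycA i (Path⁺-map (λ {i} e → trans (if-not (S i)) e) p)

  splice-numRoots : ∀ S A B → numRoots (splice S A B)
                    ≡ countF (λ i → S i ∧ isSink A i) + countF (λ i → not (S i) ∧ isSink B i)
  splice-numRoots S A B = trans (countF-cong isSink-splice) (countF-if S (isSink A) (isSink B))
    where
    isSink-splice : ∀ i → isSink (splice S A B) i ≡ (if S i then isSink A i else isSink B i)
    isSink-splice i with S i
    ... | true  = refl
    ... | false = refl

  restrict-arc : ∀ {D : Fin N → Bool} {F i j} → D i ≡ true → D j ≡ true → as F i j ≡ true →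
                 as (F ∣ D) i j ≡ true
  restrict-arc di dj e rewrite di | dj = e

  closed-∧ : ∀ {D : Fin N → Bool} {F i} → NoOut D F → D i ≡ true → ∀ j → D j ∧ as F i j ≡ as F i j
  closed-∧ {D} {F} {i} closed di j with as F i j in e
  ... | true  = trans (∧-identityʳ (D j)) (closed i j di e)
  ... | false = ∧-zeroʳ (D j)

  Sink-restrict : ∀ {D F r} → Sink F r → Sink (F ∣ D) r
  Sink-restrict {D} {F} {r} sink j rewrite sink j = trans (cong (D r ∧_) (∧-zeroʳ (D j))) (∧-zeroʳ (D r))

  Path⁺-restrict : ∀ {D : Fin N → Bool} {F x y} → NoOut D F → D x ≡ true → Path⁺ F x y →
                   D y ≡ true × Path⁺ (F ∣ D) x y
  Path⁺-restrict {D} {F} closed dx [ e ] = let dy = closed _ _ dx e in dy , [ restrict-arc {D = D} {F} dx dy e ]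
  Path⁺-restrict {D} {F} closed dx (e ∷ p) =
    let dj = closed _ _ dx e
        dy , q = Path⁺-restrict {D = D} {F} closed dj p
    in dy , restrict-arc {D = D} {F} dx dj e ∷ q

  Reach*-restrict : ∀ {D : Fin N → Bool} {F x y} → NoOut D F → D x ≡ true → Reach* F x y →
                    D y ≡ true × Reach* (F ∣ D) x y
  Reach*-restrict closed dx (inj₁ refl) = dx , inj₁ refl
  Reach*-restrict {D} {F} closed dx (inj₂ p) = let dy , q = Path⁺-restrict {D = D} {F} closed dx p in dy , inj₂ q

  restrictOut≐restrict : ∀ {D F} → NoOut D F → (F ∣↑ D) ≐ (F ∣ D)
  restrictOut≐restrict {D} {F} closed = same-vertices , same-arcs
    where
    same-vertices : ∀ j → (D j ∨ anyF (λ i → D i ∧ as F i j)) ≡ D j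
    same-vertices j with D j in dj
    ... | true  = refl
    ... | false = ∀⇒anyF≡false _ no-arc-in
      where
      no-arc-in : ∀ i → D i ∧ as F i j ≡ false
      no-arc-in i with D i in di
      ... | false = refl
      ... | true  = trans (sym (closed-∧ {D} {F} closed di j)) (cong (_∧ as F i j) dj)

    same-arcs : ∀ i j → (D i ∧ as F i j) ≡ (D i ∧ D j ∧ as F i j)
    same-arcs i j with D i in di
    ... | false = refl
    ... | true  = sym (closed-∧ {D} {F} closed di j)

module MinimumForests {c ℓ} (W : OrderedAbelianGroup c ℓ) {N : ℕ}
  (V : Fin N → Fin N → Bool) (v : Fin N → Fin N → OrderedAbelianGroup.Carrier W) where

  open OrderedAbelianGroup W using (Carrier; 0#; -_; isAbelianGroup; isTotalOrder; +-monoˡ-≤)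
    renaming (_+_ to _⊕_; _≤_ to _≼_)
  open IsAbelianGroup isAbelianGroup using (assoc; comm; inverseʳ; identityʳ; isCommutativeSemigroup)
  open IsTotalOrder isTotalOrder using () renaming (trans to ≼-trans)
  open Weighted W V v using (sumF; Υ; IsSubgraph; Forest; SF; MinSF; Tree; MinTree; TreeSetOf; Atom; gen)

  ⊕-commutativeSemigroup : CommutativeSemigroup c c
  ⊕-commutativeSemigroup = record { isCommutativeSemigroup = isCommutativeSemigroup }

  open import Algebra.Properties.CommutativeSemigroup ⊕-commutativeSemigroup using (interchange)

  ⊕-monoʳ-≼ : ∀ z {x y} → x ≼ y → z ⊕ x ≼ z ⊕ y
  ⊕-monoʳ-≼ z {x} {y} x≼y = subst₂ _≼_ (comm x z) (comm y z) (+-monoˡ-≤ z x≼y)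

  ⊕-cancelʳ-≼ : ∀ z {x y} → x ⊕ z ≼ y ⊕ z → x ≼ y
  ⊕-cancelʳ-≼ z {x} {y} h = subst₂ _≼_ (cancel x) (cancel y) (+-monoˡ-≤ (- z) h)
    where
    cancel : ∀ a → a ⊕ z ⊕ - z ≡ a
    cancel a = trans (assoc a z (- z)) (trans (cong (a ⊕_) (inverseʳ z)) (identityʳ a))

  balance-≼ : ∀ {a b c d} → a ⊕ b ≡ c ⊕ d → d ≼ a → b ≼ c
  balance-≼ {a} {b} {c} {d} sum d≼a =
    ⊕-cancelʳ-≼ d (subst (b ⊕ d ≼_) (trans (comm b a) sum) (⊕-monoʳ-≼ b d≼a))

  balance-≼′ : ∀ {a b c d} → a ⊕ b ≡ c ⊕ d → c ≼ b → a ≼ d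
  balance-≼′ {a} {b} {c} {d} sum = balance-≼ (trans (comm b a) (trans sum (comm c d)))

  sumF-cong : ∀ {n} {f g : Fin n → Carrier} → (∀ i → f i ≡ g i) → sumF f ≡ sumF g
  sumF-cong {zero}  f≗g = refl
  sumF-cong {suc n} f≗g = cong₂ _⊕_ (f≗g zero) (sumF-cong (f≗g ∘ suc))

  sumF-⊕ : ∀ {n} (f g : Fin n → Carrier) → sumF (λ i → f i ⊕ g i) ≡ sumF f ⊕ sumF g
  sumF-⊕ {zero}  f g = sym (identityʳ 0#)
  sumF-⊕ {suc n} f g = trans (cong (f zero ⊕ g zero ⊕_) (sumF-⊕ (f ∘ suc) (g ∘ suc))) (interchange _ _ _ _)

  Row : Graph N → Fin N → Carrier
  Row G i = sumF (λ j → if as G i j then v i j else 0#)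

  Υ-cong : ∀ {G H} → (∀ i j → as G i j ≡ as H i j) → Υ G ≡ Υ H
  Υ-cong G≗H = sumF-cong (λ i → sumF-cong (λ j → cong (λ b → if b then v i j else 0#) (G≗H i j)))

  Υ-splice-exchange : ∀ S A B → Υ (splice S A B) ⊕ Υ (splice S B A) ≡ Υ A ⊕ Υ B
  Υ-splice-exchange S A B = begin
    Υ (splice S A B) ⊕ Υ (splice S B A)
      ≡⟨ sym (sumF-⊕ (Row (splice S A B)) (Row (splice S B A))) ⟩
    sumF (λ i → Row (splice S A B) i ⊕ Row (splice S B A) i)
      ≡⟨ sumF-cong rows ⟩
    sumF (λ i → Row A i ⊕ Row B i)
      ≡⟨ sumF-⊕ (Row A) (Row B) ⟩
    Υ A ⊕ Υ B ∎
    where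
    open ≡-Reasoning
    rows : ∀ i → Row (splice S A B) i ⊕ Row (splice S B A) i ≡ Row A i ⊕ Row B i
    rows i with S i
    ... | true  = refl
    ... | false = comm _ _

  restrict-forest : ∀ {F D} → Forest F → Forest (F ∣ D)
  restrict-forest {F} {D} (sub , outDeg , acyclic) = sub′ , outDeg′ , acyclic′
    where
    arc : ∀ {i j} → as (F ∣ D) i j ≡ true → as F i j ≡ true
    arc {i} e = ∧-conicalʳ _ _ (∧-conicalʳ (D i) _ e)

    sub′ : IsSubgraph (F ∣ D)
    sub′ i j e =
      ∧-conicalˡ _ _ e , ∧-conicalˡ _ _ (∧-conicalʳ (D i) _ e) , proj₂ (proj₂ (sub i j (arc e)))

    outDeg′ : OutDegree≤1 (F ∣ D)
    outDeg′ i j j′ e e′ = outDeg i j j′ (arc e) (arc e′)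

    acyclic′ : Acyclic (F ∣ D)
    acyclic′ i p = acyclic i (Path⁺-map arc p)

  splice-forest : ∀ {S A B} → Acyclic (splice S A B) → Forest A → Forest B → Forest (splice S A B)
  splice-forest {S} {A} {B} acyclic (subA , outA , _) (subB , outB , _) =
    sub , splice-outDegree≤1 {S = S} {A} {B} outA outB , acyclic
    where
    sub : IsSubgraph (splice S A B)
    sub i j e with S i
    ... | true  = refl , refl , proj₂ (proj₂ (subA i j e))
    ... | false = refl , refl , proj₂ (proj₂ (subB i j e))

  treeRoot : ∀ {D T} → Tree D T → Fin N
  treeRoot (_ , _ , r , _) = r

  Tree-closed : ∀ {D T} → Tree D T → NoOut D T
  Tree-closed ((sub , _) , vsT , _) i j _ e = trans (sym (vsT j)) (proj₁ (proj₂ (sub i j e)))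

  Tree-outside : ∀ {D T i} → Tree D T → D i ≡ false → ∀ j → as T i j ≡ false
  Tree-outside {D} {T} {i} ((sub , _) , vsT , _) di j with as T i j in e
  ... | false = refl
  ... | true  = ⊥-elim (true≢false (trans (sym (trans (sym (vsT i)) (proj₁ (sub i j e)))) di))

  Tree-sink-unique : ∀ {D T x} (t : Tree D T) → D x ≡ true → Sink T x → x ≡ treeRoot t
  Tree-sink-unique (_ , vsT , _ , _ , reach) dx sink = Sink-Reach*⇒≡ sink (reach _ (trans (vsT _) dx))

  countF-sinks-tree : ∀ {D T} → Tree D T → countF (λ i → D i ∧ isSink T i) ≡ 1
  countF-sinks-tree {D} {T} t@(_ , vsT , r , (vs-r , sink) , _) =
    countF-unique _ (cong₂ _∧_ (trans (sym (vsT r)) vs-r) (Sink⇒isSink {G = T} sink))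
      (λ x h → Tree-sink-unique t (∧-conicalˡ _ _ h) (isSink⇒Sink {G = T} (∧-conicalʳ _ _ h)))

  countF-sinks-restrict : ∀ {D F} → NoOut D F → Tree D (F ∣ D) → countF (λ i → D i ∧ isSink F i) ≡ 1
  countF-sinks-restrict {D} {F} closed t@(_ , _ , r , (dr , sink) , _) =
    countF-unique _ (cong₂ _∧_ dr (Sink⇒isSink {G = F} sinkF))
      (λ x h → Tree-sink-unique t (∧-conicalˡ _ _ h)
                 (Sink-restrict {D = D} {F} (isSink⇒Sink {G = F} (∧-conicalʳ _ _ h))))
    where
    sinkF : Sink F r
    sinkF j with as F r j in e
    ... | false = refl
    ... | true  = ⊥-elim (true≢false (trans (sym (restrict-arc {D = D} {F} dr (closed r j dr e) e)) (sink j)))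

  restrict-tree : ∀ {D F x₀} → Forest F → NoOut D F → D x₀ ≡ true → AtMostOneSinkIn D F →
                  Tree D (F ∣ D)
  restrict-tree {D} {F} {x₀} forest@(_ , outDeg , acyclic) closed dx₀ atMostOne =
    restrict-forest forest , (λ _ → refl) , r₀ , (dr₀ , Sink-restrict {D = D} {F} (rootOf-sink x₀)) , reach
    where
    open Roots outDeg acyclic

    r₀ : Fin N
    r₀ = rootOf x₀

    dr₀ : D r₀ ≡ true
    dr₀ = proj₁ (Reach*-restrict closed dx₀ (rootOf-reach x₀))

    reach : ∀ x → D x ≡ true → Reach* (F ∣ D) x r₀
    reach x dx = let dr , x↝r = Reach*-restrict closed dx (rootOf-reach x)
                 in subst (Reach* (F ∣ D) x) (atMostOne dr dr₀ (rootOf-sink x) (rootOf-sink x₀)) x↝r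

  splice-tree-SF : ∀ {k D F T} → SF k F → NoOut D F → Tree D (F ∣ D) → Tree D T → SF k (splice D T F)
  splice-tree-SF {k} {D} {F} {T}
    (forestF@(_ , _ , acyclicF) , spanning , roots) closed treeF treeT@(forestT@(_ , _ , acyclicT) , _) =
    splice-forest (splice-acyclic (Tree-closed treeT) acyclicT acyclicF) forestT forestF ,
    (λ _ → refl) , roots′
    where
    open ≡-Reasoning
    roots′ : numRoots (splice D T F) ≡ k
    roots′ = begin
      numRoots (splice D T F)
        ≡⟨ splice-numRoots D T F ⟩
      countF (λ i → D i ∧ isSink T i) + countF (λ i → not (D i) ∧ isSink F i)
        ≡⟨ cong (_+ _) (trans (countF-sinks-tree treeT) (sym (countF-sinks-restrict {D} {F} closed treeF))) ⟩
      countF (λ i → D i ∧ isSink F i) + countF (λ i → not (D i) ∧ isSink F i)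
        ≡⟨ sym (countF-split D (isSink F)) ⟩
      countF (isSink F)
        ≡⟨ sym (numRoots-spanning spanning) ⟩
      numRoots F
        ≡⟨ roots ⟩
      k ∎

  Υ-splice-tree : ∀ {D F T} → NoOut D F → Tree D T → Υ (splice D T F) ⊕ Υ (F ∣ D) ≡ Υ T ⊕ Υ F
  Υ-splice-tree {D} {F} {T} closed treeT =
    trans (cong (Υ (splice D T F) ⊕_) (Υ-cong {F ∣ D} {splice D F T} arcs)) (Υ-splice-exchange D T F)
    where
    arcs : ∀ i j → as (F ∣ D) i j ≡ as (splice D F T) i j
    arcs i j with D i in di
    ... | true  = closed-∧ {D = D} {F} closed di j
    ... | false = sym (Tree-outside treeT di j)

  splice-tree-restrict : ∀ {D T B} → Tree D T → (splice D T B ∣ D) ≐ T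
  splice-tree-restrict {D} {T} {B} treeT@(_ , vsT , _) = (λ i → sym (vsT i)) , arcs
    where
    arcs : ∀ i j → (D i ∧ D j ∧ as (splice D T B) i j) ≡ as T i j
    arcs i j with D i in di
    ... | true  = closed-∧ {D = D} {T} (Tree-closed treeT) di j
    ... | false = sym (Tree-outside treeT di j)

  restrict-minTree : ∀ {k D F} → MinSF k F → NoOut D F → Tree D (F ∣ D) → MinTree D (F ∣ D)
  restrict-minTree {D = D} {F} (sfF , minF) closed treeF =
    treeF , λ T treeT →
      balance-≼ (Υ-splice-tree {D} {F} closed treeT) (minF (splice D T F) (splice-tree-SF sfF closed treeF treeT))

  splice-minTree-minSF : ∀ {k D F T} → MinSF k F → NoOut D F → Tree D (F ∣ D) → MinTree D T →
                         MinSF k (splice D T F)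
  splice-minTree-minSF {D = D} {F} {T} (sfF , minF) closed treeF (treeT , minT) =
    splice-tree-SF sfF closed treeF treeT ,
    λ H sfH → ≼-trans (balance-≼′ (Υ-splice-tree {D} {F} closed treeT) (minT (F ∣ D) treeF)) (minF H sfH)

  minSF-suc-keeping-sinks : ∀ {k G F} → MinSF (suc k) G → MinSF k F →
                            ∃[ Y ] (MinSF (suc k) Y × (∀ {x} → Sink F x → Sink Y x))
  minSF-suc-keeping-sinks {k} {G} {F}
    ((forestG@(_ , outDegG , acyclicG) , spanningG , rootsG) , minG)
    ((forestF@(_ , _ , acyclicF) , spanningF , rootsF) , minF) =
    Y , (sfY , λ H sfH → ≼-trans Y≼G (minG H sfH)) , keepsSinks
    where
    open Roots outDegG acyclicG

    sinksG : countF (isSink G) ≡ suc k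
    sinksG = trans (sym (numRoots-spanning spanningG)) rootsG

    sinksF : countF (isSink F) ≡ k
    sinksF = trans (sym (numRoots-spanning spanningF)) rootsF

    uncovered : ∃[ y ] (isSink G y ≡ true × ∀ x → isSink F x ≡ true → rootOf x ≢ y)
    uncovered = countF-<⇒uncovered (isSink G) (isSink F) rootOf
                  (subst₂ ℕ._<_ (sym sinksF) (sym sinksG) (n<1+n k))

    y : Fin N
    y = proj₁ uncovered

    sinkʸ : Sink G y
    sinkʸ = isSink⇒Sink {G = G} (proj₁ (proj₂ uncovered))

    outside : ∀ x → isSink F x ≡ true → treeOf y x ≡ false
    outside x sx = dec-false (rootOf x ≟ y) (proj₂ (proj₂ uncovered) x sx)

    Y X : Graph N
    Y = splice (treeOf y) G F
    X = splice (treeOf y) F G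

    keepsSinks : ∀ {x} → Sink F x → Sink Y x
    keepsSinks {x} sink j =
      trans (splice-outside {S = treeOf y} {G} {F} (outside x (Sink⇒isSink {G = F} sink))) (sink j)

    sfY : SF (suc k) Y
    sfY = splice-forest (splice-acyclic treeOf-closed acyclicG acyclicF) forestG forestF , (λ _ → refl) ,
          trans (splice-numRoots (treeOf y) G F)
                (cong₂ _+_ (countF-treeOf-sinks sinkʸ)
                           (trans (countF-not-∧≡countF (treeOf y) (isSink F) outside) sinksF))

    sfX : SF k X
    sfX = splice-forest (splice-acyclicᶜ treeOf-closedᶜ acyclicF acyclicG) forestF forestG , (λ _ → refl) ,
          trans (splice-numRoots (treeOf y) F G)
                (cong₂ _+_ (countF-∧≡0 (treeOf y) (isSink F) outside)
                           (suc-injective (trans (countF-sinks-outside-treeOf sinkʸ) sinksG)))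

    Y≼G : Υ Y ≼ Υ G
    Y≼G = balance-≼ (trans (Υ-splice-exchange (treeOf y) F G) (comm (Υ F) (Υ G))) (minF X sfX)

  atom⊆tree : ∀ {k Z Y r} → Atom k Z → MinSF k Y → Sink Y r → Z r ≡ true →
              ∀ {x} → Z x ≡ true → Reach* Y x r
  atom⊆tree {k} {Z} {Y} {r} (_ , _ , atomic) minY@(((_ , outDeg , acyclic) , spanning , _) , _) sink zr {x} zx =
    [ (λ Z⊆tree → treeOf-sound (Z⊆tree x zx))
    , (λ Z∩tree≡∅ → ⊥-elim (true≢false
                      (trans (sym (treeOf-complete sink (inj₁ refl))) (Z∩tree≡∅ r zr))))
    ]′ (atomic (treeOf r) (gen Y r minY (spanning r , sink) treeSet))
    where
    open Roots outDeg acyclic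

    treeSet : TreeSetOf Y r (treeOf r)
    treeSet i = (λ t → spanning i , treeOf-sound t) , (λ (_ , i↝r) → treeOf-complete sink i↝r)

  atom-atMostOneSink : ∀ {k Z G F} → Atom (suc k) Z → MinSF (suc k) G → MinSF k F → AtMostOneSinkIn Z F
  atom-atMostOneSink atom minG minF z₁ z₂ sink₁ sink₂ =
    let Y , minY , keepsSinks = minSF-suc-keeping-sinks minG minF
    in sym (Sink-Reach*⇒≡ (keepsSinks sink₂) (atom⊆tree atom minY (keepsSinks sink₁) z₁ z₂))

-- Of the hypotheses only these consequences are used: 𝓕̃^{k-1} and 𝓕̃^k are nonempty (witnessed by
-- the φ hypothesis and by the label of Z), Z is an atom of 𝔄_k, and no arc of a forest in 𝓕̃^{k-1}
-- leaves Z.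
theorem6 : ∀ {c ℓ} (W : OrderedAbelianGroup c ℓ) (N : ℕ)
    (V : Fin N → Fin N → Bool) (v : Fin N → Fin N → OrderedAbelianGroup.Carrier W) →
    let open Weighted W V v in
    (∀ i → V i i ≡ false) →
    (∃[ T ] SF 1 T) →
    (k : ℕ) → 2 ≤ k → k ≤ N ∸ 1 →
    (∃[ a ] ∃[ b ] ∃[ d ] (IsPhi (k ∸ 1) a × IsPhi k b × IsPhi (suc k) d × b - d < a - b)) →
    (Z : Fin N → Bool) → LabeledAtom k Z →
    (∀ F → MinSF (k ∸ 1) F → NoOut Z F) →
    (∀ F → MinSF (k ∸ 1) F → ((F ∣↑ Z) ≐ (F ∣ Z)) × MinTree Z (F ∣ Z))
    × (∀ T → MinTree Z T → ∃[ Q ] (MinSF (k ∸ 1) Q × ((Q ∣↑ Z) ≐ (Q ∣ Z)) × ((Q ∣ Z) ≐ T)))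
theorem6 W N V v _ _ (suc (suc k)) (s≤s (s≤s _)) _ (_ , _ , _ , (F₀ , minF₀ , _) , _)
         Z (atom@(_ , (_ , zx₀) , _) , G , _ , minG , _) noOut =
  (λ F minF → restrictOut≐restrict {F = F} (noOut F minF) , restrict-minTree minF (noOut F minF) (tree F minF)) ,
  λ T minT → let minQ = splice-minTree-minSF minF₀ (noOut F₀ minF₀) (tree F₀ minF₀) minT
             in splice Z T F₀ , minQ , restrictOut≐restrict {F = splice Z T F₀} (noOut _ minQ) ,
                splice-tree-restrict {B = F₀} (proj₁ minT)
  where
  open Weighted W V v using (MinSF; Tree)
  open MinimumForests W V v

  tree : ∀ F → MinSF (suc k) F → Tree Z (F ∣ Z)
  tree F minF = restrict-tree (proj₁ (proj₁ minF)) (noOut F minF) zx₀ (atom-atMostOneSink atom minG minF)
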